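{- Let $n\ge1$ and $k\ge0$. The set $NC(n,k)$ is in bijection with the set of ordered pairs $(A,B)$ of subsets of $\{1,\dots,n\}$ with $|A|=\lfloor k/2\rfloor$ and $|B|=\lceil k/2\rceil$.
   Context: A matching of size $n$ is a collection of pairwise disjoint $2$-element subsets (arcs) of $\{1,\dots,n\}$; not every element need be matched. $\Phi(n)$ is the set of matchings of size $n$ in which each unmatched element is labelled $\alpha$, labelled $\alpha\theta$, or unlabelled. $NC(n)$ is the set of $m\in\Phi(n)$ with no crossing (no $i<j<k<l$ with $\{i,k\},\{j,l\}$ both arcs) and no $\alpha$ label under an arc (no $i<j<l$ with $\{i,l\}$ an arc and $j$ unmatched labelled $\alpha$). $NC(n,k)$ is the set of $m\in NC(n)$ with $\#(\alpha\text{ labels})+2\#(\alpha\theta\text{ labels})+2\#(\text{arcs})=k$. -}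

module Defs where

open import Data.Bool using (Bool; true; false; _∧_; not; T)
open import Data.Nat using (ℕ; zero; suc; _+_; ⌊_/2⌋; ⌈_/2⌉)
open import Data.Fin using (Fin; _<?_; _≟_)
open import Data.Fin.Subset using (Subset; ∣_∣)
open import Data.Vec using (Vec; lookup)
open import Data.List using (List; foldr)
open import Data.List.Base using (allFin)
open import Data.Product using (Σ; _×_; _,_)
open import Relation.Nullary.Decidable using (⌊_⌋)
open import Relation.Binary.PropositionalEquality using (_≡_)

-- Status of an element i ∈ {1..n} (represented by Fin n) in a labelled
-- matching: matched to some j (an arc {i,j}), unmatched & unlabelled,
-- unmatched labelled α, or unmatched labelled αθ.
data Lab (n : ℕ) : Set where
  arc   : Fin n → Lab n
  unl   : Lab n
  α     : Lab n
  αθ    : Lab n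

Config : ℕ → Set
Config n = Vec (Lab n) n

allF : {n : ℕ} → (Fin n → Bool) → Bool
allF {n} p = foldr (λ i b → p i ∧ b) true (allFin n)

isArcTo : {n : ℕ} → Lab n → Fin n → Bool
isArcTo (arc j) k = ⌊ j ≟ k ⌋
isArcTo unl     k = false
isArcTo α       k = false
isArcTo αθ      k = false

isα : {n : ℕ} → Lab n → Bool
isα α = true
isα _ = false

-- Partner relation is an involution without fixed points, i.e. the arcs are
-- pairwise disjoint 2-element subsets.
matchingOK : {n : ℕ} → Config n → Bool
matchingOK {n} v = allF λ i → check i (lookup v i)
  where
  check : Fin n → Lab n → Bool
  check i (arc j) = not ⌊ i ≟ j ⌋ ∧ isArcTo (lookup v j) i
  check i _       = true

Φ : ℕ → Set
Φ n = Σ (Config n) λ v → T (matchingOK v)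

_<ᵇ_ : {n : ℕ} → Fin n → Fin n → Bool
i <ᵇ j = ⌊ i <? j ⌋

noCrossing : {n : ℕ} → Config n → Bool
noCrossing v = allF λ i → allF λ j → allF λ k → allF λ l →
  not (i <ᵇ j ∧ j <ᵇ k ∧ k <ᵇ l ∧ isArcTo (lookup v i) k ∧ isArcTo (lookup v j) l)

noAlphaUnderArc : {n : ℕ} → Config n → Bool
noAlphaUnderArc v = allF λ i → allF λ j → allF λ l →
  not (i <ᵇ j ∧ j <ᵇ l ∧ isArcTo (lookup v i) l ∧ isα (lookup v j))

-- weight contribution: each matched element contributes 1 (so an arc
-- contributes 2), α contributes 1, αθ contributes 2.
labWeight : {n : ℕ} → Lab n → ℕ
labWeight (arc _) = 1
labWeight unl     = 0
labWeight α       = 1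
labWeight αθ      = 2

weight : {n : ℕ} → Config n → ℕ
weight v = Data.Vec.foldr _ (λ l acc → labWeight l + acc) 0 v

NC : ℕ → ℕ → Set
NC n k = Σ (Config n) λ v →
  T (matchingOK v) × T (noCrossing v) × T (noAlphaUnderArc v) × weight v ≡ k

SubsetPairs : ℕ → ℕ → Set
SubsetPairs n k = Σ (Subset n × Subset n) λ where
  (A , B) → ∣ A ∣ ≡ ⌊ k /2⌋ × ∣ B ∣ ≡ ⌈ k /2⌉

module Submission where

-- Put i ∈ {1,…,n} into A if it opens an arc, is labelled αθ, or is one of the last ⌊a/2⌋ of
-- the a points labelled α, and into B if it closes an arc, is labelled αθ, or is one of the
-- first ⌈a/2⌉ α's. Read A-only points as "(" and B-only points as ")". Noncrossingness and the
-- absence of α's under arcs say precisely that the arcs are the matched pairs of parentheses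
-- and the α's the unmatched ones, where all unmatched ")" come before all unmatched "(".
-- So the configuration is recovered from (A, B) by matching, from right to left, each A-only
-- point with the first unmatched B-only point to its right. Finally |A| + |B| = k and
-- |B| − |A| = ⌈a/2⌉ − ⌊a/2⌋ ∈ {0, 1}, which pins down |A| = ⌊k/2⌋ and |B| = ⌈k/2⌉; conversely,
-- for a pair of these sizes the decoded α's are split into the first ⌈a/2⌉ and the rest.

open import Defs
open import Data.Bool using (Bool; true; false; T; not; _∧_)
open import Data.Bool.Properties using (T-∧; T-irrelevant)
open import Data.Empty using (⊥; ⊥-elim)
open import Data.Fin using (Fin; zero; suc; _<_; _≟_; _<?_)
open import Data.Fin.Properties using (<-cmp; <-irrefl; suc-injective)
open import Data.Fin.Subset using (Subset; ∣_∣)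
open import Data.List as List using (List; []; _∷_; allFin)
open import Data.List.Membership.Propositional.Properties using (∈-allFin)
open import Data.List.Relation.Unary.All as All using (All; []; _∷_)
open import Data.Nat using (ℕ; zero; suc; _+_; _≤_; z≤n; s≤s; z<s; s<s; ⌊_/2⌋; ⌈_/2⌉)
open import Data.Nat.Properties
  using (≡-irrelevant; +-suc; +-assoc; +-comm; +-identityʳ; +-cancelˡ-≡; +-cancelʳ-≡;
         ⌊n/2⌋+⌈n/2⌉≡n; ⌈n/2⌉≤n; n≡⌊n+n/2⌋; n≡⌈n+n/2⌉)
open import Data.Nat.Tactic.RingSolver using (solve-∀)
open import Data.Product using (Σ; _×_; _,_; proj₁; proj₂)
open import Data.Product.Function.NonDependent.Propositional using (_×-⇔_)
open import Data.Sum using (_⊎_; inj₁; inj₂)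
open import Data.Unit using (tt)
open import Data.Vec as Vec using (Vec; []; _∷_; lookup; tabulate; zip)
open import Data.Vec.Properties
  using (lookup∘tabulate; tabulate∘lookup; tabulate-cong; map-proj₁-zip; map-proj₂-zip)
open import Data.Vec.Functional as Vector using (Vector; updateAt) renaming (_∷_ to _∷ᶠ_)
open import Data.Vec.Functional.Properties using (updateAt-updates; updateAt-minimal)
open import Function using (_∘_; const)
open import Function.Bundles using (_⇔_; mk⇔; Equivalence; _↔_; mk↔ₛ′; _⤖_)
open import Function.Construct.Composition using (_⇔-∘_)
open import Function.Properties.Inverse using (↔⇒⤖)
open import Function.Related.TypeIsomorphisms using (¬-cong-⇔)
open import Relation.Binary.Definitions using (tri<; tri≈; tri>)
open import Relation.Binary.PropositionalEquality
open import Relation.Nullary using (¬_; yes; no; Dec; contradiction)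
open import Relation.Nullary.Decidable using (⌊_⌋; toWitness; fromWitness)

private
  variable
    n m : ℕ

open Equivalence using (to; from)

T-not-⇔ : ∀ {b} {P : Set} → T b ⇔ P → T (not b) ⇔ (¬ P)
T-not-⇔ {b} e = ¬-cong-⇔ e ⇔-∘ T-not b
  where
  T-not : ∀ b → T (not b) ⇔ (¬ T b)
  T-not true  = mk⇔ (λ ()) (λ ¬t → ¬t tt)
  T-not false = mk⇔ (λ _ ()) (const tt)

T-∧-⇔ : ∀ {a b} {P Q : Set} → T a ⇔ P → T b ⇔ Q → T (a ∧ b) ⇔ (P × Q)
T-∧-⇔ p q = (p ×-⇔ q) ⇔-∘ T-∧

T-dec : {P : Set} {d : Dec P} → T ⌊ d ⌋ ⇔ P
T-dec = mk⇔ toWitness fromWitness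

T-foldr-∧ : {A : Set} {p : A → Bool} (xs : List A) →
            T (List.foldr (λ x b → p x ∧ b) true xs) ⇔ All (T ∘ p) xs
T-foldr-∧ []       = mk⇔ (const []) (const tt)
T-foldr-∧ (x ∷ xs) = mk⇔ (λ (px , pxs) → px ∷ to (T-foldr-∧ xs) pxs)
                         (λ { (px ∷ pxs) → px , from (T-foldr-∧ xs) pxs }) ⇔-∘ T-∧

allF-⇔ : {p : Fin n → Bool} {P : Fin n → Set} → (∀ i → T (p i) ⇔ P i) → T (allF p) ⇔ (∀ i → P i)
allF-⇔ {n} e = mk⇔
  (λ h i → to (e i) (All.lookup (to (T-foldr-∧ (allFin n)) h) (∈-allFin i)))
  (λ h → from (T-foldr-∧ (allFin n)) (All.universal (λ i → from (e i) (h i)) (allFin n)))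

T-<ᵇ : (i j : Fin n) → T (i <ᵇ j) ⇔ i < j
T-<ᵇ i j = T-dec {d = i <? j}

T-isArcTo : (x : Lab n) {k : Fin n} → T (isArcTo x k) ⇔ x ≡ arc k
T-isArcTo (arc j) = mk⇔ (cong arc ∘ toWitness) λ { refl → fromWitness refl }
T-isArcTo unl     = mk⇔ (λ ()) (λ ())
T-isArcTo α       = mk⇔ (λ ()) (λ ())
T-isArcTo αθ      = mk⇔ (λ ()) (λ ())

T-isα : (x : Lab n) → T (isα x) ⇔ x ≡ α
T-isα (arc j) = mk⇔ (λ ()) (λ ())
T-isα unl     = mk⇔ (λ ()) (λ ())
T-isα α       = mk⇔ (const refl) (const tt)
T-isα αθ      = mk⇔ (λ ()) (λ ())

IsMatching NonCrossing NoαUnderArc : Config n → Set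
IsMatching c  = ∀ i j → lookup c i ≡ arc j → i ≢ j × lookup c j ≡ arc i
NonCrossing c = ∀ i j k l → ¬ (i < j × j < k × k < l × lookup c i ≡ arc k × lookup c j ≡ arc l)
NoαUnderArc c = ∀ i j l → ¬ (i < j × j < l × lookup c i ≡ arc l × lookup c j ≡ α)

-- The pointwise test of matchingOK is local to Defs; unification recovers it.
matchingTest : (c : Config n) → Σ (Fin n → Bool) λ p → matchingOK c ≡ allF p
matchingTest c = _ , refl

T-matchingTest : (c : Config n) (i : Fin n) →
                 T (proj₁ (matchingTest c) i) ⇔ (∀ j → lookup c i ≡ arc j → i ≢ j × lookup c j ≡ arc i)
T-matchingTest c i with lookup c i
... | arc j = mk⇔ (λ h → λ { _ refl → to test h }) (λ h → from test (h j refl))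
  where
  test : T (not ⌊ i ≟ j ⌋ ∧ isArcTo (lookup c j) i) ⇔ (i ≢ j × lookup c j ≡ arc i)
  test = T-∧-⇔ (T-not-⇔ T-dec) (T-isArcTo (lookup c j))
... | unl = mk⇔ (λ _ _ ()) (const tt)
... | α   = mk⇔ (λ _ _ ()) (const tt)
... | αθ  = mk⇔ (λ _ _ ()) (const tt)

matchingOK-⇔ : (c : Config n) → T (matchingOK c) ⇔ IsMatching c
matchingOK-⇔ c = allF-⇔ (T-matchingTest c)

noCrossing-⇔ : (c : Config n) → T (noCrossing c) ⇔ NonCrossing c
noCrossing-⇔ c = allF-⇔ λ i → allF-⇔ λ j → allF-⇔ λ k → allF-⇔ λ l →
  T-not-⇔ (T-∧-⇔ (T-<ᵇ i j) (T-∧-⇔ (T-<ᵇ j k) (T-∧-⇔ (T-<ᵇ k l)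
    (T-∧-⇔ (T-isArcTo (lookup c i)) (T-isArcTo (lookup c j))))))

noAlphaUnderArc-⇔ : (c : Config n) → T (noAlphaUnderArc c) ⇔ NoαUnderArc c
noAlphaUnderArc-⇔ c = allF-⇔ λ i → allF-⇔ λ j → allF-⇔ λ l →
  T-not-⇔ (T-∧-⇔ (T-<ᵇ i j) (T-∧-⇔ (T-<ᵇ j l)
    (T-∧-⇔ (T-isArcTo (lookup c i)) (T-isα (lookup c j)))))

-- Configurations with split α labels

-- α↓ is an α read as an unmatched closing point, α↑ as an unmatched opening point.
data Lab⁺ (n : ℕ) : Set where
  arc⁺ : Fin n → Lab⁺ n
  unl⁺ αθ⁺ α↓ α↑ : Lab⁺ n

Config⁺ : ℕ → Set
Config⁺ n = Vector (Lab⁺ n) n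

forget : Lab⁺ n → Lab n
forget (arc⁺ j) = arc j
forget unl⁺     = unl
forget αθ⁺      = αθ
forget α↓       = α
forget α↑       = α

data Free {n : ℕ} : Lab⁺ n → Set where
  α↓-free : Free α↓
  α↑-free : Free α↑

shift : Lab⁺ n → Lab⁺ (suc n)
shift (arc⁺ j) = arc⁺ (suc j)
shift unl⁺     = unl⁺
shift αθ⁺      = αθ⁺
shift α↓       = α↓
shift α↑       = α↑

-- Deleting the point 0 turns its partner into an unmatched closing point.
unshift : Lab⁺ (suc n) → Lab⁺ n
unshift (arc⁺ zero)    = α↓
unshift (arc⁺ (suc j)) = arc⁺ j
unshift unl⁺           = unl⁺
unshift αθ⁺            = αθ⁺
unshift α↓             = α↓
unshift α↑             = α↑

unshift-shift : (y : Lab⁺ n) → unshift (shift y) ≡ y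
unshift-shift (arc⁺ j) = refl
unshift-shift unl⁺     = refl
unshift-shift αθ⁺      = refl
unshift-shift α↓       = refl
unshift-shift α↑       = refl

arc⁺-injective : {i j : Fin n} → arc⁺ i ≡ arc⁺ j → i ≡ j
arc⁺-injective refl = refl

shift-injective : {x y : Lab⁺ n} → shift x ≡ shift y → x ≡ y
shift-injective {x = x} {y} e =
  trans (sym (unshift-shift x)) (trans (cong unshift e) (unshift-shift y))

shift≢arc⁺zero : (y : Lab⁺ n) → shift y ≢ arc⁺ zero
shift≢arc⁺zero (arc⁺ j) ()
shift≢arc⁺zero unl⁺     ()
shift≢arc⁺zero αθ⁺      ()
shift≢arc⁺zero α↓       ()
shift≢arc⁺zero α↑       ()

unshift⁻ : {y : Lab⁺ (suc n)} {x : Lab⁺ n} → unshift y ≡ x →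
           (y ≡ arc⁺ zero × x ≡ α↓) ⊎ y ≡ shift x
unshift⁻ {y = arc⁺ zero}    refl = inj₁ (refl , refl)
unshift⁻ {y = arc⁺ (suc j)} refl = inj₂ refl
unshift⁻ {y = unl⁺}         refl = inj₂ refl
unshift⁻ {y = αθ⁺}          refl = inj₂ refl
unshift⁻ {y = α↓}           refl = inj₂ refl
unshift⁻ {y = α↑}           refl = inj₂ refl

free-cases : {y : Lab⁺ n} → Free y → y ≡ α↓ ⊎ y ≡ α↑
free-cases α↓-free = inj₁ refl
free-cases α↑-free = inj₂ refl

free-shift⁻ : (y : Lab⁺ n) → Free (shift y) → Free y
free-shift⁻ α↓ _ = α↓-free
free-shift⁻ α↑ _ = α↑-free

free-unshift⁻ : (y : Lab⁺ (suc n)) → Free (unshift y) → y ≡ arc⁺ zero ⊎ Free y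
free-unshift⁻ (arc⁺ zero) _ = inj₁ refl
free-unshift⁻ α↓          _ = inj₂ α↓-free
free-unshift⁻ α↑          _ = inj₂ α↑-free

forget-arc : {y : Lab⁺ n} {j : Fin n} → forget y ≡ arc j → y ≡ arc⁺ j
forget-arc {y = arc⁺ _} refl = refl

free-forget : {y : Lab⁺ n} → Free y → forget y ≡ α
free-forget α↓-free = refl
free-forget α↑-free = refl

forget-free : {y : Lab⁺ n} → forget y ≡ α → Free y
forget-free {y = α↓} _ = α↓-free
forget-free {y = α↑} _ = α↑-free

DownsFirst : Vector (Lab⁺ n) m → Set
DownsFirst f = ∀ {i j} → i < j → f i ≡ α↑ → f j ≢ α↓

record Valid (f : Config⁺ n) : Set where
  field
    matching    : ∀ {i j} → f i ≡ arc⁺ j → i ≢ j × f j ≡ arc⁺ i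
    noncrossing : ∀ {i j k l} → i < j → j < k → k < l → f i ≡ arc⁺ k → f j ≡ arc⁺ l → ⊥
    freeOutside : ∀ {i j l} → i < j → j < l → f i ≡ arc⁺ l → Free (f j) → ⊥
    downsFirst  : DownsFirst f

tail⁺ : Config⁺ (suc n) → Config⁺ n
tail⁺ f = unshift ∘ f ∘ suc

module _ {f : Config⁺ (suc n)} (V : Valid f) where
  open Valid V

  partner₀ : ∀ {q} → f (suc q) ≡ arc⁺ zero → f zero ≡ arc⁺ (suc q)
  partner₀ e = proj₂ (matching e)

  tail⁺-arc : ∀ {i j} → tail⁺ f i ≡ arc⁺ j → f (suc i) ≡ arc⁺ (suc j)
  tail⁺-arc e with unshift⁻ e
  ... | inj₂ e′ = e′

  valid-tail⁺ : Valid (tail⁺ f)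
  valid-tail⁺ = record
    { matching    = λ e → let i≢j , fj = matching (tail⁺-arc e) in i≢j ∘ cong suc , cong unshift fj
    ; noncrossing = λ i<j j<k k<l ei ej →
        noncrossing (s<s i<j) (s<s j<k) (s<s k<l) (tail⁺-arc ei) (tail⁺-arc ej)
    ; freeOutside = outside
    ; downsFirst  = downs
    }
    where
    outside : ∀ {i j l} → i < j → j < l → tail⁺ f i ≡ arc⁺ l → Free (tail⁺ f j) → ⊥
    outside i<j j<l ei fj with free-unshift⁻ _ fj
    ... | inj₂ fj′  = freeOutside (s<s i<j) (s<s j<l) (tail⁺-arc ei) fj′
    ... | inj₁ j↦0 = noncrossing z<s (s<s i<j) (s<s j<l) (partner₀ j↦0) (tail⁺-arc ei)

    downs : DownsFirst (tail⁺ f)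
    downs i<j ei ej with unshift⁻ ei | unshift⁻ ej
    ... | inj₂ ei′ | inj₂ ej′      = downsFirst (s<s i<j) ei′ ej′
    ... | inj₂ ei′ | inj₁ (j↦0 , _) =
      freeOutside z<s (s<s i<j) (partner₀ j↦0) (subst Free (sym ei′) α↑-free)

valid-∷shift : {r : Config⁺ n} → Valid r → (y : Lab⁺ (suc n)) → (∀ {j} → y ≢ arc⁺ j) →
               (y ≡ α↑ → ∀ i → r i ≢ α↓) → Valid (y ∷ᶠ shift ∘ r)
valid-∷shift {n} {r} V y y-no-arc y-opens = record
  { matching = match ; noncrossing = cross ; freeOutside = outside ; downsFirst = downs }
  where
  open Valid V
  F : Config⁺ (suc n)
  F = y ∷ᶠ shift ∘ r

  match : ∀ {i j} → F i ≡ arc⁺ j → i ≢ j × F j ≡ arc⁺ i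
  match {zero}            e = ⊥-elim (y-no-arc e)
  match {suc i} {zero}    e = ⊥-elim (shift≢arc⁺zero (r i) e)
  match {suc i} {suc j}   e =
    let i≢j , rj = matching (shift-injective {y = arc⁺ j} e) in i≢j ∘ suc-injective , cong shift rj

  cross : ∀ {i j k l} → i < j → j < k → k < l → F i ≡ arc⁺ k → F j ≡ arc⁺ l → ⊥
  cross {zero} _ _ _ ei _ = y-no-arc ei
  cross {suc i} {suc j} {suc k} {suc l} (s<s i<j) (s<s j<k) (s<s k<l) ei ej =
    noncrossing i<j j<k k<l (shift-injective {y = arc⁺ k} ei) (shift-injective {y = arc⁺ l} ej)

  outside : ∀ {i j l} → i < j → j < l → F i ≡ arc⁺ l → Free (F j) → ⊥
  outside {zero} _ _ ei _ = y-no-arc ei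
  outside {suc i} {suc j} {suc l} (s<s i<j) (s<s j<l) ei fj =
    freeOutside i<j j<l (shift-injective {y = arc⁺ l} ei) (free-shift⁻ (r j) fj)

  downs : DownsFirst F
  downs {zero}  {suc j} _ ei ej = y-opens ei j (shift-injective {y = α↓} ej)
  downs {suc i} {suc j} (s<s i<j) ei ej =
    downsFirst i<j (shift-injective {y = α↑} ei) (shift-injective {y = α↓} ej)

IsFirstDown : Vector (Lab⁺ n) m → Fin m → Set
IsFirstDown r p = r p ≡ α↓ × (∀ {q} → q < p → r q ≢ α↓)

firstDown-unique : {r : Vector (Lab⁺ n) m} {p q : Fin m} → IsFirstDown r p → IsFirstDown r q → p ≡ q
firstDown-unique {p = p} {q} (rp , before-p) (rq , before-q) with <-cmp p q
... | tri< p<q _ _ = contradiction rp (before-q p<q)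
... | tri≈ _ p≡q _ = p≡q
... | tri> _ _ q<p = contradiction rq (before-p q<p)

data DownView (r : Vector (Lab⁺ n) m) : Set where
  noDown    : (∀ i → r i ≢ α↓) → DownView r
  firstDown : ∀ p → IsFirstDown r p → DownView r

α↓? : (y : Lab⁺ n) → Dec (y ≡ α↓)
α↓? (arc⁺ j) = no λ ()
α↓? unl⁺     = no λ ()
α↓? αθ⁺      = no λ ()
α↓? α↓       = yes refl
α↓? α↑       = no λ ()

downView : (r : Vector (Lab⁺ n) m) → DownView r
downView {m = zero}  r = noDown λ ()
downView {m = suc m} r with α↓? (r zero) | downView (r ∘ suc)
... | yes r₀ | _ = firstDown zero (r₀ , λ ())
... | no r₀ | noDown none = noDown λ { zero → r₀ ; (suc i) → none i }
... | no r₀ | firstDown p (rp , before-p) =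
  firstDown (suc p) (rp , λ { {zero} _ → r₀ ; {suc q} (s<s q<p) → before-p q<p })

joinFirstDown : Config⁺ n → Fin n → Config⁺ (suc n)
joinFirstDown r p = arc⁺ (suc p) ∷ᶠ updateAt (shift ∘ r) p (const (arc⁺ zero))

module _ {r : Config⁺ n} {p : Fin n} where
  private
    h : Vector (Lab⁺ (suc n)) n
    h = updateAt (shift ∘ r) p (const (arc⁺ zero))

  joinFirstDown-view : ∀ q → (q ≡ p × h q ≡ arc⁺ zero) ⊎ (q ≢ p × h q ≡ shift (r q))
  joinFirstDown-view q with q ≟ p
  ... | yes refl = inj₁ (refl , updateAt-updates q (shift ∘ r))
  ... | no q≢p  = inj₂ (q≢p , updateAt-minimal q p (shift ∘ r) q≢p)

  valid-joinFirstDown : Valid r → IsFirstDown r p → Valid (joinFirstDown r p)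
  valid-joinFirstDown V (rp , before-p) = record
    { matching = match ; noncrossing = cross ; freeOutside = outside ; downsFirst = downs }
    where
    open Valid V
    F : Config⁺ (suc n)
    F = joinFirstDown r p

    h-arc : ∀ {q m} → h q ≡ arc⁺ (suc m) → r q ≡ arc⁺ m
    h-arc {q} {m} e with joinFirstDown-view q
    ... | inj₁ (_ , hq)  = contradiction (trans (sym e) hq) λ ()
    ... | inj₂ (_ , hq)  = shift-injective {y = arc⁺ m} (trans (sym hq) e)

    h-free : ∀ {q} → Free (h q) → q ≢ p × Free (r q)
    h-free {q} fq with joinFirstDown-view q
    ... | inj₁ (_ , hq) with () ← subst Free hq fq
    h-free {q} fq | inj₂ (q≢p , hq) = q≢p , free-shift⁻ (r q) (subst Free hq fq)

    h-point : ∀ {q} x → h q ≡ shift x → r q ≡ x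
    h-point {q} x e with joinFirstDown-view q
    ... | inj₁ (_ , hq) = ⊥-elim (shift≢arc⁺zero x (trans (sym e) hq))
    ... | inj₂ (_ , hq) = shift-injective (trans (sym hq) e)

    match : ∀ {i j} → F i ≡ arc⁺ j → i ≢ j × F j ≡ arc⁺ i
    match {zero} refl = (λ ()) , updateAt-updates p (shift ∘ r)
    match {suc i} {j} e with joinFirstDown-view i
    match {suc i} {zero}  e | inj₁ (refl , _)  = (λ ()) , refl
    match {suc i} {suc j} e | inj₁ (_ , hi)    = contradiction (trans (sym e) hi) λ ()
    match {suc i} {zero}  e | inj₂ (_ , hi)    = ⊥-elim (shift≢arc⁺zero (r i) (trans (sym hi) e))
    match {suc i} {suc j} e | inj₂ (i≢p , hi)
      with matching (shift-injective {y = arc⁺ j} (trans (sym hi) e))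
    ... | i≢j , rj with joinFirstDown-view j
    ...   | inj₁ (refl , _) = contradiction (trans (sym rp) rj) λ ()
    ...   | inj₂ (_ , hj)   = i≢j ∘ suc-injective , trans hj (cong shift rj)

    cross : ∀ {i j k l} → i < j → j < k → k < l → F i ≡ arc⁺ k → F j ≡ arc⁺ l → ⊥
    cross {zero} {suc j} {suc k} {suc l} _ (s<s j<k) (s<s k<l) refl ej =
      freeOutside j<k k<l (h-arc ej) (subst Free (sym rp) α↓-free)
    cross {suc i} {suc j} {suc k} {suc l} (s<s i<j) (s<s j<k) (s<s k<l) ei ej =
      noncrossing i<j j<k k<l (h-arc ei) (h-arc ej)

    outside : ∀ {i j l} → i < j → j < l → F i ≡ arc⁺ l → Free (F j) → ⊥
    outside {zero} {suc j} _ (s<s j<p) refl fj with free-cases (proj₂ (h-free fj))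
    ... | inj₁ rj = before-p j<p rj
    ... | inj₂ rj = downsFirst j<p rj rp
    outside {suc i} {suc j} {suc l} (s<s i<j) (s<s j<l) ei fj =
      freeOutside i<j j<l (h-arc ei) (proj₂ (h-free fj))

    downs : DownsFirst F
    downs {suc i} {suc j} (s<s i<j) ei ej =
      downsFirst i<j (h-point α↑ ei) (h-point α↓ ej)

-- The letter at i is (i ∈ A , i ∈ B).
Step : Set
Step = Bool × Bool

open↑ : (r : Config⁺ n) → DownView r → Config⁺ (suc n)
open↑ r (noDown _)      = α↑ ∷ᶠ shift ∘ r
open↑ r (firstDown p _) = joinFirstDown r p

prepend : Step → Config⁺ n → Config⁺ (suc n)
prepend (false , false) r = unl⁺ ∷ᶠ shift ∘ r
prepend (true  , true)  r = αθ⁺ ∷ᶠ shift ∘ r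
prepend (false , true)  r = α↓ ∷ᶠ shift ∘ r
prepend (true  , false) r = open↑ r (downView r)

decode : Vec Step n → Config⁺ n
decode []      = λ ()
decode (s ∷ w) = prepend s (decode w)

-- The first point of a valid configuration can only open an arc; tail⁺ turns its partner
-- into α↓, which is later encoded as closing.
step : Lab⁺ n → Step
step (arc⁺ _) = true  , false
step unl⁺     = false , false
step αθ⁺      = true  , true
step α↓       = false , true
step α↑       = true  , false

encode : Config⁺ n → Vec Step n
encode {zero}  _ = []
encode {suc n} f = step (f zero) ∷ encode (tail⁺ f)

valid-prepend : ∀ s {r : Config⁺ n} → Valid r → Valid (prepend s r)
valid-prepend (false , false) V = valid-∷shift V unl⁺ (λ ()) (λ ())
valid-prepend (true  , true)  V = valid-∷shift V αθ⁺ (λ ()) (λ ())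
valid-prepend (false , true)  V = valid-∷shift V α↓ (λ ()) (λ ())
valid-prepend (true  , false) {r} V with downView r
... | noDown none      = valid-∷shift V α↑ (λ ()) (λ _ → none)
... | firstDown p first = valid-joinFirstDown V first

valid-decode : (w : Vec Step n) → Valid (decode w)
valid-decode [] = record
  { matching = λ { {()} } ; noncrossing = λ { {()} } ; freeOutside = λ { {()} } ; downsFirst = λ { {()} } }
valid-decode (s ∷ w) = valid-prepend s (valid-decode w)

encode-cong : {f g : Config⁺ n} → f ≗ g → encode f ≡ encode g
encode-cong {zero}  e = refl
encode-cong {suc n} e = cong₂ _∷_ (cong step (e zero)) (encode-cong (cong unshift ∘ e ∘ suc))

step-prepend : ∀ s (r : Config⁺ n) → step (prepend s r zero) ≡ s
step-prepend (false , false) r = refl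
step-prepend (true  , true)  r = refl
step-prepend (false , true)  r = refl
step-prepend (true  , false) r with downView r
... | noDown _      = refl
... | firstDown _ _ = refl

tail⁺-prepend : ∀ s (r : Config⁺ n) → tail⁺ (prepend s r) ≗ r
tail⁺-prepend (false , false) r i = unshift-shift (r i)
tail⁺-prepend (true  , true)  r i = unshift-shift (r i)
tail⁺-prepend (false , true)  r i = unshift-shift (r i)
tail⁺-prepend (true  , false) r i with downView r
... | noDown _ = unshift-shift (r i)
... | firstDown p (rp , _) with joinFirstDown-view {r = r} {p} i
...   | inj₁ (refl , hi) = trans (cong unshift hi) (sym rp)
...   | inj₂ (_ , hi)    = trans (cong unshift hi) (unshift-shift (r i))

encode-decode : (w : Vec Step n) → encode (decode w) ≡ w
encode-decode []      = refl
encode-decode (s ∷ w) =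
  cong₂ _∷_ (step-prepend s (decode w))
            (trans (encode-cong (tail⁺-prepend s (decode w))) (encode-decode w))

∷shift-cong : ∀ (y : Lab⁺ (suc n)) {r r′ : Config⁺ n} → r ≗ r′ → (y ∷ᶠ shift ∘ r) ≗ (y ∷ᶠ shift ∘ r′)
∷shift-cong y e zero    = refl
∷shift-cong y e (suc i) = cong shift (e i)

isFirstDown-cong : {r r′ : Config⁺ n} {p : Fin n} → r ≗ r′ → IsFirstDown r p → IsFirstDown r′ p
isFirstDown-cong e (rp , before-p) = trans (sym (e _)) rp , λ q<p → before-p q<p ∘ trans (e _)

joinFirstDown-cong : {r r′ : Config⁺ n} (p : Fin n) → r ≗ r′ → joinFirstDown r p ≗ joinFirstDown r′ p
joinFirstDown-cong p e zero = refl
joinFirstDown-cong {r = r} {r′} p e (suc i) with i ≟ p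
... | yes refl = trans (updateAt-updates i (shift ∘ r)) (sym (updateAt-updates i (shift ∘ r′)))
... | no i≢p  = trans (updateAt-minimal i p (shift ∘ r) i≢p)
                      (trans (cong shift (e i)) (sym (updateAt-minimal i p (shift ∘ r′) i≢p)))

open↑-cong : {r r′ : Config⁺ n} → r ≗ r′ → (v : DownView r) (v′ : DownView r′) →
             open↑ r v ≗ open↑ r′ v′
open↑-cong e (noDown _) (noDown _) = ∷shift-cong α↑ e
open↑-cong e (noDown none) (firstDown p (rp , _)) = ⊥-elim (none p (trans (e p) rp))
open↑-cong e (firstDown p (rp , _)) (noDown none) = ⊥-elim (none p (trans (sym (e p)) rp))
open↑-cong e (firstDown p first) (firstDown p′ first′)
  with refl ← firstDown-unique (isFirstDown-cong e first) first′ = joinFirstDown-cong p e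

prepend-cong : ∀ s {r r′ : Config⁺ n} → r ≗ r′ → prepend s r ≗ prepend s r′
prepend-cong (false , false) e = ∷shift-cong unl⁺ e
prepend-cong (true  , true)  e = ∷shift-cong αθ⁺ e
prepend-cong (false , true)  e = ∷shift-cong α↓ e
prepend-cong (true  , false) {r} {r′} e = open↑-cong e (downView r) (downView r′)

module _ {f : Config⁺ (suc n)} (V : Valid f) where
  open Valid V

  shift-tail⁺ : ∀ {i} → f zero ≢ arc⁺ (suc i) → shift (tail⁺ f i) ≡ f (suc i)
  shift-tail⁺ f₀≢ with unshift⁻ refl
  ... | inj₁ (fi , _) = contradiction (partner₀ V fi) f₀≢
  ... | inj₂ fi       = sym fi

  ∷shift-tail⁺ : ∀ {y} → f zero ≡ y → (∀ {j} → y ≢ arc⁺ j) → (y ∷ᶠ shift ∘ tail⁺ f) ≗ f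
  ∷shift-tail⁺ f₀ y-no-arc zero    = sym f₀
  ∷shift-tail⁺ f₀ y-no-arc (suc i) = shift-tail⁺ (y-no-arc ∘ trans (sym f₀))

  tail⁺-noDown : f zero ≡ α↑ → ∀ i → tail⁺ f i ≢ α↓
  tail⁺-noDown f₀ i e with unshift⁻ e
  ... | inj₁ (fi , _) = contradiction (trans (sym f₀) (partner₀ V fi)) λ ()
  ... | inj₂ fi       = downsFirst z<s f₀ fi

  tail⁺-firstDown : ∀ {p} → f zero ≡ arc⁺ (suc p) → IsFirstDown (tail⁺ f) p
  tail⁺-firstDown {p} f₀ = cong unshift (proj₂ (matching f₀)) , before-p
    where
    before-p : ∀ {q} → q < p → tail⁺ f q ≢ α↓
    before-p q<p e with unshift⁻ e
    ... | inj₁ (fq , _) = <-irrefl (suc-injective (arc⁺-injective (trans (sym (partner₀ V fq)) f₀))) q<p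
    ... | inj₂ fq       = freeOutside z<s (s<s q<p) f₀ (subst Free (sym fq) α↓-free)

  joinFirstDown-tail⁺ : ∀ {p} → f zero ≡ arc⁺ (suc p) → joinFirstDown (tail⁺ f) p ≗ f
  joinFirstDown-tail⁺ f₀ zero = sym f₀
  joinFirstDown-tail⁺ {p} f₀ (suc i) with i ≟ p
  ... | yes refl = trans (updateAt-updates i (shift ∘ tail⁺ f)) (sym (proj₂ (matching f₀)))
  ... | no i≢p  = trans (updateAt-minimal i p (shift ∘ tail⁺ f) i≢p)
                        (shift-tail⁺ (i≢p ∘ sym ∘ suc-injective ∘ arc⁺-injective ∘ trans (sym f₀)))

  prepend-step-tail⁺ : prepend (step (f zero)) (tail⁺ f) ≗ f
  prepend-step-tail⁺ with f zero in f₀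
  ... | unl⁺ = ∷shift-tail⁺ f₀ λ ()
  ... | αθ⁺  = ∷shift-tail⁺ f₀ λ ()
  ... | α↓   = ∷shift-tail⁺ f₀ λ ()
  ... | α↑ with downView (tail⁺ f)
  ...   | noDown _             = ∷shift-tail⁺ f₀ λ ()
  ...   | firstDown p (rp , _) = ⊥-elim (tail⁺-noDown f₀ p rp)
  prepend-step-tail⁺ | arc⁺ zero = ⊥-elim (proj₁ (matching f₀) refl)
  prepend-step-tail⁺ | arc⁺ (suc p) with downView (tail⁺ f)
  ... | noDown none = ⊥-elim (none p (proj₁ (tail⁺-firstDown f₀)))
  ... | firstDown p′ first with refl ← firstDown-unique first (tail⁺-firstDown f₀) =
    joinFirstDown-tail⁺ f₀

decode-encode : {f : Config⁺ n} → Valid f → decode (encode f) ≗ f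
decode-encode {suc n} {f} V i =
  trans (prepend-cong (step (f zero)) (decode-encode (valid-tail⁺ V)) i) (prepend-step-tail⁺ V i)

Balanced : ℕ → ℕ → Set
Balanced x y = y ≡ x ⊎ y ≡ suc x

balanced-halves : ∀ m → Balanced ⌊ m /2⌋ ⌈ m /2⌉
balanced-halves zero          = inj₁ refl
balanced-halves (suc zero)    = inj₂ refl
balanced-halves (suc (suc m)) with balanced-halves m
... | inj₁ e = inj₁ (cong suc e)
... | inj₂ e = inj₂ (cong suc e)

balanced⇒halves : ∀ {x y} → Balanced x y → x ≡ ⌊ x + y /2⌋ × y ≡ ⌈ x + y /2⌉
balanced⇒halves {x} (inj₁ refl) = n≡⌊n+n/2⌋ x , n≡⌈n+n/2⌉ x
balanced⇒halves {x} (inj₂ refl) rewrite +-suc x x = n≡⌈n+n/2⌉ x , cong suc (n≡⌊n+n/2⌋ x)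

balanced-split : ∀ {x y m} → x + y ≡ m → y ≡ ⌈ m /2⌉ → Balanced x y
balanced-split {x} {y} {m} x+y≡m refl =
  subst (λ z → Balanced z y) (+-cancelʳ-≡ y ⌊ m /2⌋ x (trans (⌊n/2⌋+⌈n/2⌉≡n m) (sym x+y≡m)))
        (balanced-halves m)

balanced-transfer : ∀ {u d a b} → u + b ≡ d + a → Balanced u d → Balanced a b
balanced-transfer {u} {a = a} {b} e (inj₁ refl) = inj₁ (+-cancelˡ-≡ u b a e)
balanced-transfer {u} {a = a} {b} e (inj₂ refl) =
  inj₂ (+-cancelˡ-≡ u b (suc a) (trans e (sym (+-suc u a))))

setA setB : Vec Step n → Subset n
setA = Vec.map proj₁
setB = Vec.map proj₂

tally : {A : Set} → (A → ℕ) → Vector A m → ℕ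
tally g = Vector.foldr (λ x t → g x + t) 0

tally-cong : {A B : Set} {g : A → ℕ} {g′ : B → ℕ} {f : Vector A m} {f′ : Vector B m} →
             (∀ i → g (f i) ≡ g′ (f′ i)) → tally g f ≡ tally g′ f′
tally-cong {zero}  e = refl
tally-cong {suc m} e = cong₂ _+_ (e zero) (tally-cong (e ∘ suc))

tally-updateAt : {A : Set} (g : A → ℕ) (xs : Vector A m) (p : Fin m) (h : A → A) →
                 tally g (updateAt xs p h) + g (xs p) ≡ tally g xs + g (h (xs p))
tally-updateAt g xs zero h = swap (g (h (xs zero))) (tally g (xs ∘ suc)) (g (xs zero))
  where
  swap : ∀ a t b → a + t + b ≡ b + t + a
  swap = solve-∀
tally-updateAt g xs (suc p) h = begin
  x₀ + tally g (updateAt (xs ∘ suc) p h) + g (xs (suc p))   ≡⟨ +-assoc x₀ _ _ ⟩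
  x₀ + (tally g (updateAt (xs ∘ suc) p h) + g (xs (suc p))) ≡⟨ cong (x₀ +_) (tally-updateAt g (xs ∘ suc) p h) ⟩
  x₀ + (tally g (xs ∘ suc) + g (h (xs (suc p))))           ≡⟨ +-assoc x₀ _ _ ⟨
  tally g xs + g (h (xs (suc p)))                           ∎
  where
  open ≡-Reasoning
  x₀ : ℕ
  x₀ = g (xs zero)

δ↓ δ↑ : Lab⁺ n → ℕ
δ↓ α↓ = 1
δ↓ _  = 0
δ↑ α↑ = 1
δ↑ _  = 0

δ↓-shift : (y : Lab⁺ n) → δ↓ (shift y) ≡ δ↓ y
δ↓-shift (arc⁺ _) = refl
δ↓-shift unl⁺     = refl
δ↓-shift αθ⁺      = refl
δ↓-shift α↓       = refl
δ↓-shift α↑       = refl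

δ↑-shift : (y : Lab⁺ n) → δ↑ (shift y) ≡ δ↑ y
δ↑-shift (arc⁺ _) = refl
δ↑-shift unl⁺     = refl
δ↑-shift αθ⁺      = refl
δ↑-shift α↓       = refl
δ↑-shift α↑       = refl

tally↑-shift : (r : Vector (Lab⁺ n) m) → tally δ↑ (shift ∘ r) ≡ tally δ↑ r
tally↑-shift r = tally-cong (δ↑-shift ∘ r)

tally↓-shift : (r : Vector (Lab⁺ n) m) → tally δ↓ (shift ∘ r) ≡ tally δ↓ r
tally↓-shift r = tally-cong (δ↓-shift ∘ r)

module _ {r : Config⁺ n} {p : Fin n} (rp : r p ≡ α↓) where
  private
    h : Vector (Lab⁺ (suc n)) n
    h = updateAt (shift ∘ r) p (const (arc⁺ zero))
    open ≡-Reasoning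

  joinFirstDown-δ↑ : tally δ↑ (joinFirstDown r p) ≡ tally δ↑ r
  joinFirstDown-δ↑ = begin
    tally δ↑ h                             ≡⟨ +-identityʳ _ ⟨
    tally δ↑ h + 0                         ≡⟨ cong (λ y → tally δ↑ h + δ↑ (shift y)) rp ⟨
    tally δ↑ h + δ↑ (shift (r p))          ≡⟨ tally-updateAt δ↑ (shift ∘ r) p (const (arc⁺ zero)) ⟩
    tally δ↑ (shift ∘ r) + 0               ≡⟨ +-identityʳ _ ⟩
    tally δ↑ (shift ∘ r)                   ≡⟨ tally↑-shift r ⟩
    tally δ↑ r                             ∎

  joinFirstDown-δ↓ : suc (tally δ↓ (joinFirstDown r p)) ≡ tally δ↓ r
  joinFirstDown-δ↓ = begin
    suc (tally δ↓ h)                       ≡⟨ +-comm 1 _ ⟩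
    tally δ↓ h + 1                         ≡⟨ cong (λ y → tally δ↓ h + δ↓ (shift y)) rp ⟨
    tally δ↓ h + δ↓ (shift (r p))          ≡⟨ tally-updateAt δ↓ (shift ∘ r) p (const (arc⁺ zero)) ⟩
    tally δ↓ (shift ∘ r) + 0               ≡⟨ +-identityʳ _ ⟩
    tally δ↓ (shift ∘ r)                   ≡⟨ tally↓-shift r ⟩
    tally δ↓ r                             ∎

balance-decode : (w : Vec Step n) →
                 tally δ↑ (decode w) + ∣ setB w ∣ ≡ tally δ↓ (decode w) + ∣ setA w ∣
balance-decode [] = refl
balance-decode ((false , false) ∷ w)
  rewrite tally↑-shift (decode w) | tally↓-shift (decode w) = balance-decode w
balance-decode ((true , true) ∷ w)
  rewrite tally↑-shift (decode w) | tally↓-shift (decode w)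
        | +-suc (tally δ↑ (decode w)) ∣ setB w ∣ | +-suc (tally δ↓ (decode w)) ∣ setA w ∣ =
  cong suc (balance-decode w)
balance-decode ((false , true) ∷ w)
  rewrite tally↑-shift (decode w) | tally↓-shift (decode w)
        | +-suc (tally δ↑ (decode w)) ∣ setB w ∣ = cong suc (balance-decode w)
balance-decode ((true , false) ∷ w) with downView (decode w)
... | noDown _
  rewrite tally↑-shift (decode w) | tally↓-shift (decode w)
        | +-suc (tally δ↓ (decode w)) ∣ setA w ∣ = cong suc (balance-decode w)
... | firstDown p (rp , _) = begin
  tally δ↑ (joinFirstDown r p) + ∣ setB w ∣      ≡⟨ cong (_+ ∣ setB w ∣) (joinFirstDown-δ↑ rp) ⟩
  tally δ↑ r + ∣ setB w ∣                        ≡⟨ balance-decode w ⟩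
  tally δ↓ r + ∣ setA w ∣                        ≡⟨ cong (_+ ∣ setA w ∣) (joinFirstDown-δ↓ rp) ⟨
  suc (tally δ↓ (joinFirstDown r p)) + ∣ setA w ∣ ≡⟨ +-suc _ ∣ setA w ∣ ⟨
  tally δ↓ (joinFirstDown r p) + suc ∣ setA w ∣  ∎
  where
  r = decode w
  open ≡-Reasoning

weight≡tally : (c : Config n) → weight c ≡ tally labWeight (lookup c)
weight≡tally = foldr≡tally
  where
  foldr≡tally : (v : Vec (Lab n) m) →
                Vec.foldr (λ _ → ℕ) (λ l t → labWeight l + t) 0 v ≡ tally labWeight (lookup v)
  foldr≡tally []      = refl
  foldr≡tally (x ∷ v) = cong (labWeight x +_) (foldr≡tally v)

weight-unshift : (y : Lab⁺ (suc n)) → labWeight (forget (unshift y)) ≡ labWeight (forget y)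
weight-unshift (arc⁺ zero)    = refl
weight-unshift (arc⁺ (suc j)) = refl
weight-unshift unl⁺           = refl
weight-unshift αθ⁺            = refl
weight-unshift α↓             = refl
weight-unshift α↑             = refl

weight-step : (y : Lab⁺ n) (w : Vec Step m) →
              labWeight (forget y) + (∣ setA w ∣ + ∣ setB w ∣) ≡ ∣ setA (step y ∷ w) ∣ + ∣ setB (step y ∷ w) ∣
weight-step (arc⁺ _) w = refl
weight-step unl⁺     w = refl
weight-step αθ⁺      w = cong suc (sym (+-suc ∣ setA w ∣ ∣ setB w ∣))
weight-step α↓       w = sym (+-suc ∣ setA w ∣ ∣ setB w ∣)
weight-step α↑       w = refl

weight-encode : (f : Config⁺ n) →
                tally (labWeight ∘ forget) f ≡ ∣ setA (encode f) ∣ + ∣ setB (encode f) ∣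
weight-encode {zero}  f = refl
weight-encode {suc n} f = begin
  labWeight (forget (f zero)) + tally (labWeight ∘ forget) (f ∘ suc)
    ≡⟨ cong (labWeight (forget (f zero)) +_) (tally-cong (sym ∘ weight-unshift ∘ f ∘ suc)) ⟩
  labWeight (forget (f zero)) + tally (labWeight ∘ forget) (tail⁺ f)
    ≡⟨ cong (labWeight (forget (f zero)) +_) (weight-encode (tail⁺ f)) ⟩
  labWeight (forget (f zero)) + (∣ setA (encode (tail⁺ f)) ∣ + ∣ setB (encode (tail⁺ f)) ∣)
    ≡⟨ weight-step (f zero) (encode (tail⁺ f)) ⟩
  ∣ setA (encode f) ∣ + ∣ setB (encode f) ∣ ∎
  where open ≡-Reasoning

δα : Lab n → ℕ
δα α = 1
δα _ = 0

tally-+ : {A : Set} (g h : A → ℕ) (f : Vector A m) → tally (λ x → g x + h x) f ≡ tally g f + tally h f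
tally-+ {zero}  g h f = refl
tally-+ {suc m} g h f = trans (cong (g (f zero) + h (f zero) +_) (tally-+ g h (f ∘ suc)))
                              (interchange (g (f zero)) (h (f zero)) (tally g (f ∘ suc)) (tally h (f ∘ suc)))
  where
  interchange : ∀ a b c d → a + b + (c + d) ≡ a + c + (b + d)
  interchange = solve-∀

δα-forget : (y : Lab⁺ n) → δα (forget y) ≡ δ↑ y + δ↓ y
δα-forget (arc⁺ _) = refl
δα-forget unl⁺     = refl
δα-forget αθ⁺      = refl
δα-forget α↓       = refl
δα-forget α↑       = refl

tally-α-forget : (f : Vector (Lab⁺ n) m) → tally (δα ∘ forget) f ≡ tally δ↑ f + tally δ↓ f
tally-α-forget f = trans (tally-cong (δα-forget ∘ f)) (tally-+ δ↑ δ↓ f)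

δ↓-≢ : {y : Lab⁺ n} → y ≢ α↓ → δ↓ y ≡ 0
δ↓-≢ {y = arc⁺ _} _ = refl
δ↓-≢ {y = unl⁺}   _ = refl
δ↓-≢ {y = αθ⁺}    _ = refl
δ↓-≢ {y = α↓}     y≢α↓ = contradiction refl y≢α↓
δ↓-≢ {y = α↑}     _ = refl

tally-noDown : (g : Vector (Lab⁺ n) m) → (∀ i → g i ≢ α↓) → tally δ↓ g ≡ 0
tally-noDown {m = zero}  g none = refl
tally-noDown {m = suc m} g none = cong₂ _+_ (δ↓-≢ (none zero)) (tally-noDown (g ∘ suc) (none ∘ suc))

#α : Config n → ℕ
#α c = tally δα (lookup c)

-- Splitting the α labels

refine : ℕ → Vec (Lab n) m → Vec (Lab⁺ n) m
refine d       []          = []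
refine d       (arc j ∷ c) = arc⁺ j ∷ refine d c
refine d       (unl ∷ c)   = unl⁺ ∷ refine d c
refine d       (αθ ∷ c)    = αθ⁺ ∷ refine d c
refine zero    (α ∷ c)     = α↑ ∷ refine zero c
refine (suc d) (α ∷ c)     = α↓ ∷ refine d c

forget-refine : ∀ d (c : Vec (Lab n) m) i → forget (lookup (refine d c) i) ≡ lookup c i
forget-refine d       (arc j ∷ c) zero    = refl
forget-refine d       (unl ∷ c)   zero    = refl
forget-refine d       (αθ ∷ c)    zero    = refl
forget-refine zero    (α ∷ c)     zero    = refl
forget-refine (suc d) (α ∷ c)     zero    = refl
forget-refine d       (arc j ∷ c) (suc i) = forget-refine d c i
forget-refine d       (unl ∷ c)   (suc i) = forget-refine d c i
forget-refine d       (αθ ∷ c)    (suc i) = forget-refine d c i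
forget-refine zero    (α ∷ c)     (suc i) = forget-refine zero c i
forget-refine (suc d) (α ∷ c)     (suc i) = forget-refine d c i

refine-noDown : (c : Vec (Lab n) m) → ∀ i → lookup (refine zero c) i ≢ α↓
refine-noDown (arc j ∷ c) (suc i) = refine-noDown c i
refine-noDown (unl ∷ c)   (suc i) = refine-noDown c i
refine-noDown (αθ ∷ c)    (suc i) = refine-noDown c i
refine-noDown (α ∷ c)     (suc i) = refine-noDown c i
refine-noDown (arc j ∷ c) zero    = λ ()
refine-noDown (unl ∷ c)   zero    = λ ()
refine-noDown (αθ ∷ c)    zero    = λ ()
refine-noDown (α ∷ c)     zero    = λ ()

downsFirst-refine : ∀ d (c : Vec (Lab n) m) → DownsFirst (lookup (refine d c))
downsFirst-refine zero    (α ∷ c)     {zero}  {suc j} _         _ = refine-noDown c j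
downsFirst-refine d       (arc _ ∷ c) {suc i} {suc j} (s<s i<j)   = downsFirst-refine d c i<j
downsFirst-refine d       (unl ∷ c)   {suc i} {suc j} (s<s i<j)   = downsFirst-refine d c i<j
downsFirst-refine d       (αθ ∷ c)    {suc i} {suc j} (s<s i<j)   = downsFirst-refine d c i<j
downsFirst-refine zero    (α ∷ c)     {suc i} {suc j} (s<s i<j)   = downsFirst-refine zero c i<j
downsFirst-refine (suc d) (α ∷ c)     {suc i} {suc j} (s<s i<j)   = downsFirst-refine d c i<j
downsFirst-refine d       (arc _ ∷ c) {zero}  _ ()
downsFirst-refine d       (unl ∷ c)   {zero}  _ ()
downsFirst-refine d       (αθ ∷ c)    {zero}  _ ()
downsFirst-refine (suc d) (α ∷ c)     {zero}  _ ()

refine-downs : ∀ d (c : Vec (Lab n) m) → d ≤ tally δα (lookup c) → tally δ↓ (lookup (refine d c)) ≡ d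
refine-downs zero    []          _         = refl
refine-downs d       (arc _ ∷ c) d≤a       = refine-downs d c d≤a
refine-downs d       (unl ∷ c)   d≤a       = refine-downs d c d≤a
refine-downs d       (αθ ∷ c)    d≤a       = refine-downs d c d≤a
refine-downs zero    (α ∷ c)     _         = refine-downs zero c z≤n
refine-downs (suc d) (α ∷ c)     (s≤s d≤a) = cong suc (refine-downs d c d≤a)

refine-forget : (g : Vector (Lab⁺ n) m) → DownsFirst g →
                refine (tally δ↓ g) (tabulate (forget ∘ g)) ≡ tabulate g
refine-forget {m = zero}  g D = refl
refine-forget {m = suc m} g D with g zero in g₀ | refine-forget (g ∘ suc) (D ∘ s<s)
... | arc⁺ j | ih = cong (arc⁺ j ∷_) ih
... | unl⁺   | ih = cong (unl⁺ ∷_) ih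
... | αθ⁺    | ih = cong (αθ⁺ ∷_) ih
... | α↓     | ih = cong (α↓ ∷_) ih
... | α↑     | ih with tally δ↓ (g ∘ suc) | tally-noDown (g ∘ suc) (λ j → D z<s g₀)
...   | .0 | refl = cong (α↑ ∷_) ih

NCConditions : Config n → Set
NCConditions c = T (matchingOK c) × T (noCrossing c) × T (noAlphaUnderArc c)

module _ {g : Config⁺ n} (c : Config n) (g≈c : ∀ i → forget (g i) ≡ lookup c i) where
  private
    arc-down : ∀ {i j} → g i ≡ arc⁺ j → lookup c i ≡ arc j
    arc-down {i} e = trans (sym (g≈c i)) (cong forget e)

    arc-up : ∀ {i j} → lookup c i ≡ arc j → g i ≡ arc⁺ j
    arc-up {i} e = forget-arc (trans (g≈c i) e)

  valid-refining : DownsFirst g → NCConditions c → Valid g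
  valid-refining D (m , x , a) = record
    { matching    = λ {i} {j} e → let i≢j , cj = match i j (arc-down e) in i≢j , arc-up cj
    ; noncrossing = λ {i} {j} {k} {l} i<j j<k k<l ei ej →
        cross i j k l (i<j , j<k , k<l , arc-down ei , arc-down ej)
    ; freeOutside = λ {i} {j} {l} i<j j<l ei fj →
        alpha i j l (i<j , j<l , arc-down ei , trans (sym (g≈c j)) (free-forget fj))
    ; downsFirst  = D
    }
    where
    match : IsMatching c
    match = to (matchingOK-⇔ c) m
    cross : NonCrossing c
    cross = to (noCrossing-⇔ c) x
    alpha : NoαUnderArc c
    alpha = to (noAlphaUnderArc-⇔ c) a

  refined-NC : Valid g → NCConditions c
  refined-NC V =
    from (matchingOK-⇔ c) match , from (noCrossing-⇔ c) cross , from (noAlphaUnderArc-⇔ c) alpha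
    where
    open Valid V
    match : IsMatching c
    match i j e = let i≢j , gj = matching (arc-up e) in i≢j , arc-down gj
    cross : NonCrossing c
    cross i j k l (i<j , j<k , k<l , ei , ej) = noncrossing i<j j<k k<l (arc-up ei) (arc-up ej)
    alpha : NoαUnderArc c
    alpha i j l (i<j , j<l , ei , ej) = freeOutside i<j j<l (arc-up ei) (forget-free (trans (g≈c j) ej))

balance-encode : {g : Config⁺ n} → Valid g →
                 tally δ↑ g + ∣ setB (encode g) ∣ ≡ tally δ↓ g + ∣ setA (encode g) ∣
balance-encode {g = g} V =
  subst₂ (λ u d → u + ∣ setB (encode g) ∣ ≡ d + ∣ setA (encode g) ∣)
         (tally-cong (cong δ↑ ∘ decode-encode V)) (tally-cong (cong δ↓ ∘ decode-encode V))
         (balance-decode (encode g))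

encode-sizes : ∀ {k} {g : Config⁺ n} → Valid g → Balanced (tally δ↑ g) (tally δ↓ g) →
               tally (labWeight ∘ forget) g ≡ k →
               ∣ setA (encode g) ∣ ≡ ⌊ k /2⌋ × ∣ setB (encode g) ∣ ≡ ⌈ k /2⌉
encode-sizes {g = g} V balanced refl rewrite weight-encode g =
  balanced⇒halves (balanced-transfer (balance-encode V) balanced)

weight-decode : (w : Vec Step n) → tally (labWeight ∘ forget) (decode w) ≡ ∣ setA w ∣ + ∣ setB w ∣
weight-decode w = trans (weight-encode (decode w)) (cong (λ v → ∣ setA v ∣ + ∣ setB v ∣) (encode-decode w))

decode-balanced : (w : Vec Step n) → Balanced ∣ setA w ∣ ∣ setB w ∣ →
                  Balanced (tally δ↑ (decode w)) (tally δ↓ (decode w))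
decode-balanced w =
  balanced-transfer (trans (+-comm ∣ setA w ∣ _) (trans (sym (balance-decode w)) (+-comm _ ∣ setB w ∣)))

zip-setA-setB : (w : Vec Step n) → zip (setA w) (setB w) ≡ w
zip-setA-setB []      = refl
zip-setA-setB (s ∷ w) = cong (s ∷_) (zip-setA-setB w)

NC-≡ : ∀ {n k} {x y : NC n k} → proj₁ x ≡ proj₁ y → x ≡ y
NC-≡ {x = c , m , x , a , w} {.c , m′ , x′ , a′ , w′} refl
  rewrite T-irrelevant m m′ | T-irrelevant x x′ | T-irrelevant a a′ | ≡-irrelevant w w′ = refl

SubsetPairs-≡ : ∀ {n k} {x y : SubsetPairs n k} → proj₁ x ≡ proj₁ y → x ≡ y
SubsetPairs-≡ {x = AB , a , b} {.AB , a′ , b′} refl rewrite ≡-irrelevant a a′ | ≡-irrelevant b b′ = refl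

module _ {n k : ℕ} where

  refineNC : NC n k → Config⁺ n
  refineNC (c , _) = lookup (refine ⌈ #α c /2⌉ c)

  valid-refineNC : (x : NC n k) → Valid (refineNC x)
  valid-refineNC (c , m , x , a , _) =
    valid-refining c (forget-refine ⌈ #α c /2⌉ c) (downsFirst-refine ⌈ #α c /2⌉ c) (m , x , a)

  balanced-refineNC : (x : NC n k) → Balanced (tally δ↑ (refineNC x)) (tally δ↓ (refineNC x))
  balanced-refineNC x@(c , _) = balanced-split
    (trans (sym (tally-α-forget (refineNC x))) (tally-cong (cong δα ∘ forget-refine ⌈ #α c /2⌉ c)))
    (refine-downs ⌈ #α c /2⌉ c (⌈n/2⌉≤n (#α c)))

  weight-refineNC : (x : NC n k) → tally (labWeight ∘ forget) (refineNC x) ≡ k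
  weight-refineNC (c , _ , _ , _ , weight≡k) =
    trans (tally-cong (cong labWeight ∘ forget-refine ⌈ #α c /2⌉ c)) (trans (sym (weight≡tally c)) weight≡k)

  toPair : NC n k → SubsetPairs n k
  toPair x = (setA (encode (refineNC x)) , setB (encode (refineNC x))) ,
             encode-sizes (valid-refineNC x) (balanced-refineNC x) (weight-refineNC x)

  decodePair : SubsetPairs n k → Config⁺ n
  decodePair ((A , B) , _) = decode (zip A B)

  forgetPair : SubsetPairs n k → Config n
  forgetPair y = tabulate (forget ∘ decodePair y)

  forgetPair-refined : (y : SubsetPairs n k) → ∀ i → forget (decodePair y i) ≡ lookup (forgetPair y) i
  forgetPair-refined y i = sym (lookup∘tabulate (forget ∘ decodePair y) i)

  valid-decodePair : (y : SubsetPairs n k) → Valid (decodePair y)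
  valid-decodePair ((A , B) , _) = valid-decode (zip A B)

  balanced-decodePair : (y : SubsetPairs n k) →
                        Balanced (tally δ↑ (decodePair y)) (tally δ↓ (decodePair y))
  balanced-decodePair ((A , B) , |A| , |B|) = decode-balanced (zip A B)
    (subst₂ Balanced (sym (trans (cong ∣_∣ (map-proj₁-zip A B)) |A|))
                     (sym (trans (cong ∣_∣ (map-proj₂-zip A B)) |B|))
                     (balanced-halves k))

  weight-forgetPair : (y : SubsetPairs n k) → weight (forgetPair y) ≡ k
  weight-forgetPair y@((A , B) , |A| , |B|) = begin
    weight (forgetPair y)                     ≡⟨ weight≡tally (forgetPair y) ⟩
    tally labWeight (lookup (forgetPair y))   ≡⟨ tally-cong (cong labWeight ∘ sym ∘ forgetPair-refined y) ⟩
    tally (labWeight ∘ forget) (decodePair y) ≡⟨ weight-decode (zip A B) ⟩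
    ∣ setA (zip A B) ∣ + ∣ setB (zip A B) ∣   ≡⟨ cong₂ (λ P Q → ∣ P ∣ + ∣ Q ∣) (map-proj₁-zip A B) (map-proj₂-zip A B) ⟩
    ∣ A ∣ + ∣ B ∣                             ≡⟨ cong₂ _+_ |A| |B| ⟩
    ⌊ k /2⌋ + ⌈ k /2⌉                         ≡⟨ ⌊n/2⌋+⌈n/2⌉≡n k ⟩
    k                                         ∎
    where open ≡-Reasoning

  fromPair : SubsetPairs n k → NC n k
  fromPair y with refined-NC (forgetPair y) (forgetPair-refined y) (valid-decodePair y)
  ... | matches , noncrossing , noαUnderArc =
    forgetPair y , matches , noncrossing , noαUnderArc , weight-forgetPair y

  refine-forgetPair : (y : SubsetPairs n k) →
                      refine ⌈ #α (forgetPair y) /2⌉ (forgetPair y) ≡ tabulate (decodePair y)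
  refine-forgetPair y =
    subst (λ d → refine d (forgetPair y) ≡ tabulate g) (sym downs≡)
          (refine-forget g (Valid.downsFirst (valid-decodePair y)))
    where
    g : Config⁺ n
    g = decodePair y
    downs≡ : ⌈ #α (forgetPair y) /2⌉ ≡ tally δ↓ g
    downs≡ = begin
      ⌈ #α (forgetPair y) /2⌉       ≡⟨ cong ⌈_/2⌉ (trans (tally-cong (cong δα ∘ sym ∘ forgetPair-refined y))
                                                         (tally-α-forget g)) ⟩
      ⌈ tally δ↑ g + tally δ↓ g /2⌉ ≡⟨ proj₂ (balanced⇒halves (balanced-decodePair y)) ⟨
      tally δ↓ g                    ∎
      where open ≡-Reasoning

  toPair-fromPair : (y : SubsetPairs n k) → toPair (fromPair y) ≡ y
  toPair-fromPair y@((A , B) , _) = SubsetPairs-≡ (cong₂ _,_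
      (trans (cong setA encode-refined) (map-proj₁-zip A B))
      (trans (cong setB encode-refined) (map-proj₂-zip A B)))
    where
    encode-refined : encode (refineNC (fromPair y)) ≡ zip A B
    encode-refined = trans
      (encode-cong λ i → trans (cong (λ v → lookup v i) (refine-forgetPair y))
                               (lookup∘tabulate (decodePair y) i))
      (encode-decode (zip A B))

  fromPair-toPair : (x : NC n k) → fromPair (toPair x) ≡ x
  fromPair-toPair x@(c , _) = NC-≡ (begin
    tabulate (forget ∘ decode (zip (setA w) (setB w)))
      ≡⟨ cong (λ v → tabulate (forget ∘ decode v)) (zip-setA-setB w) ⟩
    tabulate (forget ∘ decode w)
      ≡⟨ tabulate-cong forget-decode-w ⟩
    tabulate (lookup c)
      ≡⟨ tabulate∘lookup c ⟩
    c ∎)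
    where
    open ≡-Reasoning
    w : Vec Step n
    w = encode (refineNC x)
    forget-decode-w : ∀ i → forget (decode w i) ≡ lookup c i
    forget-decode-w i =
      trans (cong forget (decode-encode (valid-refineNC x) i)) (forget-refine ⌈ #α c /2⌉ c i)

NC↔SubsetPairs : (n k : ℕ) → NC n k ↔ SubsetPairs n k
NC↔SubsetPairs n k = mk↔ₛ′ toPair fromPair toPair-fromPair fromPair-toPair

proposition4p6 : (n k : ℕ) → 1 ≤ n → NC n k ⤖ SubsetPairs n k
proposition4p6 n k _ = ↔⇒⤖ (NC↔SubsetPairs n k)
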